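{- Let $(S,\circ,\bullet)$ be a partial bi-semigroup and let $(Q,\le,\circ,\bullet)$ be a bi-quantale (respectively a distributive bi-quantale). Then $(Q^S,\le,\circ,\bullet)$, with pointwise order and the two convolutions, is a bi-quantale (respectively a distributive bi-quantale). If moreover $Q$ is unital and $S$ is a partial bi-monoid, then $Q^S$ is unital.
   Context: A partial bi-semigroup $(S,\circ,\bullet)$ is a set with two partial binary operations each making it a partial semigroup (associative partial operation, undefined products denoted $\bot\notin S$); a partial bi-monoid has units $1_\circ$, $1_\bullet$ for the two operations. A bi-quantale $(Q,\le,\circ,\bullet)$ is a complete lattice with two multiplications such that $(Q,\le,\circ)$ and $(Q,\le,\bullet)$ are quantales (associative multiplication distributing over arbitrary suprema on both sides); unital if both multiplications have units; distributive if binary meets distribute over arbitrary joins and binary joins over arbitrary meets. On $Q^S$: $(f\circ g)(x)=\sum_{x=y\circ z} f(y)\circ g(z)$ and $(f\bullet g)(x)=\sum_{x=y\bullet z} f(y)\bullet g(z)$ (suprema over $y,z\in S$ with the product defined and equal to $x$); units $\mathbb{1}_\circ(x)=1_\circ$ if $x=1_\circ$ and $0$ otherwise, and analogously for $\bullet$. -}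

module Defs where

open import Level using (Level; _⊔_; suc)
open import Data.Maybe using (Maybe; just; nothing; _>>=_)
open import Data.Product using (Σ; _×_; _,_; proj₁; proj₂)
open import Relation.Binary.Core using (Rel)
open import Relation.Binary.Structures using (IsPartialOrder)
open import Relation.Binary.PropositionalEquality using (_≡_)

-- A partial operation is S → S → Maybe S (nothing = ⊥ = undefined).
-- Associativity is Kleene equality: (x∘y)∘z is defined iff x∘(y∘z) is,
-- and then they are equal.

PartialOp : ∀ {ι} → Set ι → Set ι
PartialOp S = S → S → Maybe S

PartialAssoc : ∀ {ι} {S : Set ι} → PartialOp S → Set ι
PartialAssoc {S = S} _·_ =
  ∀ (x y z : S) → ((x · y) >>= λ w → w · z) ≡ ((y · z) >>= λ w → x · w)

record PartialBiSemigroup (ι : Level) : Set (suc ι) where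
  field
    Carrier : Set ι
    _∘_     : PartialOp Carrier
    _•_     : PartialOp Carrier
    ∘-assoc : PartialAssoc _∘_
    •-assoc : PartialAssoc _•_

IsPartialUnit : ∀ {ι} {S : Set ι} → PartialOp S → S → Set ι
IsPartialUnit {S = S} _·_ e = ∀ (x : S) → (e · x ≡ just x) × (x · e ≡ just x)

record IsPartialBiMonoid {ι} (S : PartialBiSemigroup ι)
                         (1∘ 1• : PartialBiSemigroup.Carrier S) : Set ι where
  open PartialBiSemigroup S
  field
    1∘-unit : IsPartialUnit _∘_ 1∘
    1•-unit : IsPartialUnit _•_ 1•

module _ {c ℓ₁ ℓ₂ : Level} (ι : Level) {C : Set c}
         (_≈_ : Rel C ℓ₁) (_≤_ : Rel C ℓ₂) where

  record IsCompleteLattice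
           (⋁ ⋀ : ∀ {I : Set ι} → (I → C) → C)
           (_∧_ _∨_ : C → C → C) : Set (c ⊔ ℓ₁ ⊔ ℓ₂ ⊔ suc ι) where
    field
      isPartialOrder : IsPartialOrder _≈_ _≤_
      ⋁-upper : ∀ {I : Set ι} (f : I → C) (i : I) → f i ≤ ⋁ f
      ⋁-least : ∀ {I : Set ι} (f : I → C) (x : C) → (∀ i → f i ≤ x) → ⋁ f ≤ x
      ⋀-lower : ∀ {I : Set ι} (f : I → C) (i : I) → ⋀ f ≤ f i
      ⋀-great : ∀ {I : Set ι} (f : I → C) (x : C) → (∀ i → x ≤ f i) → x ≤ ⋀ f
      ∧-lowerˡ : ∀ x y → (x ∧ y) ≤ x
      ∧-lowerʳ : ∀ x y → (x ∧ y) ≤ y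
      ∧-great  : ∀ x y z → z ≤ x → z ≤ y → z ≤ (x ∧ y)
      ∨-upperˡ : ∀ x y → x ≤ (x ∨ y)
      ∨-upperʳ : ∀ x y → y ≤ (x ∨ y)
      ∨-least  : ∀ x y z → x ≤ z → y ≤ z → (x ∨ y) ≤ z

  record IsDistributiveLattice
           (⋁ ⋀ : ∀ {I : Set ι} → (I → C) → C)
           (_∧_ _∨_ : C → C → C) : Set (c ⊔ ℓ₁ ⊔ suc ι) where
    field
      ∧-distrib-⋁ : ∀ {I : Set ι} (x : C) (f : I → C) → (x ∧ ⋁ f) ≈ ⋁ (λ i → x ∧ f i)
      ∨-distrib-⋀ : ∀ {I : Set ι} (x : C) (f : I → C) → (x ∨ ⋀ f) ≈ ⋀ (λ i → x ∨ f i)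

  record IsQuantaleMult (⋁ : ∀ {I : Set ι} → (I → C) → C)
                        (_⊗_ : C → C → C) : Set (c ⊔ ℓ₁ ⊔ suc ι) where
    field
      ⊗-cong   : ∀ {x x′ y y′} → x ≈ x′ → y ≈ y′ → (x ⊗ y) ≈ (x′ ⊗ y′)
      ⊗-assoc  : ∀ x y z → ((x ⊗ y) ⊗ z) ≈ (x ⊗ (y ⊗ z))
      ⊗-distribˡ-⋁ : ∀ {I : Set ι} (x : C) (f : I → C) → (x ⊗ ⋁ f) ≈ ⋁ (λ i → x ⊗ f i)
      ⊗-distribʳ-⋁ : ∀ {I : Set ι} (f : I → C) (x : C) → (⋁ f ⊗ x) ≈ ⋁ (λ i → f i ⊗ x)

  record IsBiQuantale
           (⋁ ⋀ : ∀ {I : Set ι} → (I → C) → C)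
           (_∧_ _∨_ : C → C → C)
           (_∘_ _•_ : C → C → C) : Set (c ⊔ ℓ₁ ⊔ ℓ₂ ⊔ suc ι) where
    field
      isCompleteLattice : IsCompleteLattice ⋁ ⋀ _∧_ _∨_
      ∘-quantale : IsQuantaleMult ⋁ _∘_
      •-quantale : IsQuantaleMult ⋁ _•_

  IsUnit : (C → C → C) → C → Set (c ⊔ ℓ₁)
  IsUnit _⊗_ e = ∀ x → ((e ⊗ x) ≈ x) × ((x ⊗ e) ≈ x)

  record IsUnitalBiQuantaleUnits (_∘_ _•_ : C → C → C) (1∘ 1• : C) : Set (c ⊔ ℓ₁) where
    field
      1∘-unit : IsUnit _∘_ 1∘
      1•-unit : IsUnit _•_ 1•

record BiQuantale (c ℓ₁ ℓ₂ ι : Level) : Set (suc (c ⊔ ℓ₁ ⊔ ℓ₂ ⊔ ι)) where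
  field
    Carrier : Set c
    _≈_     : Rel Carrier ℓ₁
    _≤_     : Rel Carrier ℓ₂
    ⋁       : ∀ {I : Set ι} → (I → Carrier) → Carrier
    ⋀       : ∀ {I : Set ι} → (I → Carrier) → Carrier
    _∧_     : Carrier → Carrier → Carrier
    _∨_     : Carrier → Carrier → Carrier
    _∘_     : Carrier → Carrier → Carrier
    _•_     : Carrier → Carrier → Carrier
    isBiQuantale : IsBiQuantale ι _≈_ _≤_ ⋁ ⋀ _∧_ _∨_ _∘_ _•_

  IsDistributive : Set (c ⊔ ℓ₁ ⊔ suc ι)
  IsDistributive = IsDistributiveLattice ι _≈_ _≤_ ⋁ ⋀ _∧_ _∨_

  IsUnital : Carrier → Carrier → Set (c ⊔ ℓ₁)
  IsUnital = IsUnitalBiQuantaleUnits ι _≈_ _≤_ _∘_ _•_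

module FunctionSpace {c ℓ₁ ℓ₂ ι : Level}
                     (S : PartialBiSemigroup ι) (Q : BiQuantale c ℓ₁ ℓ₂ ι) where
  private
    module S = PartialBiSemigroup S
    module Q = BiQuantale Q

  QS : Set (ι ⊔ c)
  QS = S.Carrier → Q.Carrier

  _≈ᶠ_ : Rel QS (ι ⊔ ℓ₁)
  f ≈ᶠ g = ∀ x → f x Q.≈ g x

  _≤ᶠ_ : Rel QS (ι ⊔ ℓ₂)
  f ≤ᶠ g = ∀ x → f x Q.≤ g x

  ⋁ᶠ : ∀ {I : Set ι} → (I → QS) → QS
  ⋁ᶠ F x = Q.⋁ (λ i → F i x)

  ⋀ᶠ : ∀ {I : Set ι} → (I → QS) → QS
  ⋀ᶠ F x = Q.⋀ (λ i → F i x)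

  _∧ᶠ_ : QS → QS → QS
  (f ∧ᶠ g) x = f x Q.∧ g x

  _∨ᶠ_ : QS → QS → QS
  (f ∨ᶠ g) x = f x Q.∨ g x

  -- convolution: (f ⊛ g)(x) = ⋁_{x = y · z} f(y) ⊗ g(z)
  -- (sup over the pairs (y , z) whose partial product y · z is defined and equals x)
  conv : PartialOp S.Carrier → (Q.Carrier → Q.Carrier → Q.Carrier) → QS → QS → QS
  conv _·_ _⊗_ f g x =
    Q.⋁ {I = Σ (S.Carrier × S.Carrier) (λ p → proj₁ p · proj₂ p ≡ just x)}
        (λ i → f (proj₁ (proj₁ i)) ⊗ g (proj₂ (proj₁ i)))

  _∘ᶠ_ : QS → QS → QS
  _∘ᶠ_ = conv S._∘_ Q._∘_

  _•ᶠ_ : QS → QS → QS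
  _•ᶠ_ = conv S._•_ Q._•_

  -- unit functions: 𝟙(x) = e if x = u, and 0 otherwise, written constructively
  -- as the sup of the constant family e over the proofs of x ≡ u
  -- (which is e when x ≡ u and ⋁ ∅ = 0 otherwise).
  𝟙 : S.Carrier → Q.Carrier → QS
  𝟙 u e x = Q.⋁ {I = x ≡ u} (λ _ → e)

  IsBiQuantaleᶠ : Set (ι ⊔ c ⊔ ℓ₁ ⊔ ℓ₂ ⊔ suc ι)
  IsBiQuantaleᶠ = IsBiQuantale ι _≈ᶠ_ _≤ᶠ_ ⋁ᶠ ⋀ᶠ _∧ᶠ_ _∨ᶠ_ _∘ᶠ_ _•ᶠ_

  IsDistributiveᶠ : Set (ι ⊔ c ⊔ ℓ₁ ⊔ suc ι)
  IsDistributiveᶠ = IsDistributiveLattice ι _≈ᶠ_ _≤ᶠ_ ⋁ᶠ ⋀ᶠ _∧ᶠ_ _∨ᶠ_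

  IsUnitalᶠ : QS → QS → Set (ι ⊔ c ⊔ ℓ₁)
  IsUnitalᶠ = IsUnitalBiQuantaleUnits ι _≈ᶠ_ _≤ᶠ_ _∘ᶠ_ _•ᶠ_

module Submission where

-- The lattice structure of Q^S is the pointwise one, so the complete-lattice
-- and distributivity axioms are inherited from Q coordinatewise.  Everything else is about a
-- single partial operation _·_ on S and a single quantale multiplication _⊗_
-- on Q, and is proved once for the convolution  conv _·_ _⊗_  (module
-- Convolution) and then instantiated twice, for ∘ and for •:
--   * convolution preserves ≈ and distributes over ⋁, because ⊗ does and
--     suprema commute with suprema (⋁-swap);
--   * convolution is associative when _·_ is: partial associativity lets a
--     factorisation x = (a·b)·z be regrouped as x = a·(b·z) and vice versa
--     (regroupʳ, regroupˡ), and ⊗ is associative and distributes over ⋁;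
--   * if u is a unit of _·_ and e a unit of ⊗, then 𝟙 u e is a unit of the
--     convolution, since the only factorisation x = y·z with y ≡ u
--     (resp. z ≡ u) is x = u·x (resp. x = x·u).

open import Defs
open import Level using (Level)
open import Data.Product using (_×_; Σ; _,_; proj₁; proj₂)
open import Data.Maybe using (Maybe; just; _>>=_)
open import Data.Maybe.Properties using (just-injective)
open import Relation.Binary.Core using (Rel)
open import Relation.Binary.Bundles using (Poset)
open import Relation.Binary.Structures using (IsPartialOrder; IsEquivalence)
open import Relation.Binary.PropositionalEquality using (_≡_; refl; sym; trans; cong)
import Relation.Binary.Reasoning.PartialOrder as PosetReasoning

module CompleteLatticeFacts {c ℓ₁ ℓ₂ ι : Level} {C : Set c}
    {_≈_ : Rel C ℓ₁} {_≤_ : Rel C ℓ₂}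
    {⋁ ⋀ : ∀ {I : Set ι} → (I → C) → C} {_∧_ _∨_ : C → C → C}
    (L : IsCompleteLattice ι _≈_ _≤_ ⋁ ⋀ _∧_ _∨_) where

  open IsCompleteLattice L public
  open IsPartialOrder isPartialOrder public using (antisym; reflexive)
  module ≈ = IsEquivalence (IsPartialOrder.isEquivalence isPartialOrder)

  poset : Poset c ℓ₁ ℓ₂
  poset = record { isPartialOrder = isPartialOrder }

  open PosetReasoning poset public

  ⋁-mono : ∀ {I : Set ι} {f g : I → C} → (∀ i → f i ≤ g i) → ⋁ f ≤ ⋁ g
  ⋁-mono {f = f} {g} f≤g = ⋁-least f (⋁ g) λ i → begin
    f i   ≤⟨ f≤g i ⟩
    g i   ≤⟨ ⋁-upper g i ⟩
    ⋁ g   ∎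

  ⋁-cong : ∀ {I : Set ι} {f g : I → C} → (∀ i → f i ≈ g i) → ⋁ f ≈ ⋁ g
  ⋁-cong f≈g = antisym (⋁-mono (λ i → reflexive (f≈g i)))
                       (⋁-mono (λ i → reflexive (≈.sym (f≈g i))))

  ⋁-swap : ∀ {I J : Set ι} (F : I → J → C) →
           ⋁ (λ i → ⋁ (λ j → F i j)) ≈ ⋁ (λ j → ⋁ (λ i → F i j))
  ⋁-swap F = antisym (swap≤ F) (swap≤ (λ j i → F i j))
    where
    swap≤ : ∀ {I J : Set ι} (G : I → J → C) →
            ⋁ (λ i → ⋁ (λ j → G i j)) ≤ ⋁ (λ j → ⋁ (λ i → G i j))
    swap≤ G = ⋁-least _ _ λ i → ⋁-least _ _ λ j → begin
      G i j                         ≤⟨ ⋁-upper (λ i → G i j) i ⟩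
      ⋁ (λ i → G i j)               ≤⟨ ⋁-upper (λ j → ⋁ (λ i → G i j)) j ⟩
      ⋁ (λ j → ⋁ (λ i → G i j))     ∎

module Pointwise {a c ℓ₁ ℓ₂ ι : Level} (A : Set a) {C : Set c}
    {_≈_ : Rel C ℓ₁} {_≤_ : Rel C ℓ₂}
    {⋁ ⋀ : ∀ {I : Set ι} → (I → C) → C} {_∧_ _∨_ : C → C → C} where

  _≈ᵖ_ : Rel (A → C) _
  f ≈ᵖ g = ∀ x → f x ≈ g x

  _≤ᵖ_ : Rel (A → C) _
  f ≤ᵖ g = ∀ x → f x ≤ g x

  ⋁ᵖ ⋀ᵖ : ∀ {I : Set ι} → (I → A → C) → A → C
  ⋁ᵖ F x = ⋁ (λ i → F i x)
  ⋀ᵖ F x = ⋀ (λ i → F i x)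

  _∧ᵖ_ _∨ᵖ_ : (A → C) → (A → C) → A → C
  (f ∧ᵖ g) x = f x ∧ g x
  (f ∨ᵖ g) x = f x ∨ g x

  isCompleteLattice : IsCompleteLattice ι _≈_ _≤_ ⋁ ⋀ _∧_ _∨_ →
                      IsCompleteLattice ι _≈ᵖ_ _≤ᵖ_ ⋁ᵖ ⋀ᵖ _∧ᵖ_ _∨ᵖ_
  isCompleteLattice L = record
    { isPartialOrder = record
        { isPreorder = record
            { isEquivalence = record
                { refl  = λ x → PO.Eq.refl
                ; sym   = λ f≈g x → PO.Eq.sym (f≈g x)
                ; trans = λ f≈g g≈h x → PO.Eq.trans (f≈g x) (g≈h x) }
            ; reflexive = λ f≈g x → PO.reflexive (f≈g x)
            ; trans     = λ f≤g g≤h x → PO.trans (f≤g x) (g≤h x) }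
        ; antisym = λ f≤g g≤f x → PO.antisym (f≤g x) (g≤f x) }
    ; ⋁-upper  = λ F i x → ⋁-upper (λ i → F i x) i
    ; ⋁-least  = λ F g F≤g x → ⋁-least (λ i → F i x) (g x) (λ i → F≤g i x)
    ; ⋀-lower  = λ F i x → ⋀-lower (λ i → F i x) i
    ; ⋀-great  = λ F g g≤F x → ⋀-great (λ i → F i x) (g x) (λ i → g≤F i x)
    ; ∧-lowerˡ = λ f g x → ∧-lowerˡ (f x) (g x)
    ; ∧-lowerʳ = λ f g x → ∧-lowerʳ (f x) (g x)
    ; ∧-great  = λ f g h h≤f h≤g x → ∧-great (f x) (g x) (h x) (h≤f x) (h≤g x)
    ; ∨-upperˡ = λ f g x → ∨-upperˡ (f x) (g x)
    ; ∨-upperʳ = λ f g x → ∨-upperʳ (f x) (g x)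
    ; ∨-least  = λ f g h f≤h g≤h x → ∨-least (f x) (g x) (h x) (f≤h x) (g≤h x)
    }
    where
    open IsCompleteLattice L
    module PO = IsPartialOrder isPartialOrder

  isDistributive : IsDistributiveLattice ι _≈_ _≤_ ⋁ ⋀ _∧_ _∨_ →
                   IsDistributiveLattice ι _≈ᵖ_ _≤ᵖ_ ⋁ᵖ ⋀ᵖ _∧ᵖ_ _∨ᵖ_
  isDistributive D = record
    { ∧-distrib-⋁ = λ f F x → ∧-distrib-⋁ (f x) (λ i → F i x)
    ; ∨-distrib-⋀ = λ f F x → ∨-distrib-⋀ (f x) (λ i → F i x) }
    where open IsDistributiveLattice D

bind-just : ∀ {ι} {A B : Set ι} (m : Maybe A) (k : A → Maybe B) {x : B} →
            (m >>= k) ≡ just x → Σ A (λ v → (m ≡ just v) × (k v ≡ just x))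
bind-just (just v) k mk≡x = v , refl , mk≡x

module Regroup {ι} {A : Set ι} {_·_ : PartialOp A} (·-assoc : PartialAssoc _·_) where

  regroupʳ : ∀ {a b y z x} → a · b ≡ just y → y · z ≡ just x →
             Σ A (λ v → (b · z ≡ just v) × (a · v ≡ just x))
  regroupʳ {a} {b} {y} {z} ab yz =
    bind-just (b · z) (a ·_) (trans (sym (·-assoc a b z))
                                    (trans (cong (_>>= (_· z)) ab) yz))

  regroupˡ : ∀ {a b v z x} → b · z ≡ just v → a · v ≡ just x →
             Σ A (λ y → (a · b ≡ just y) × (y · z ≡ just x))
  regroupˡ {a} {b} {v} {z} bz av =
    bind-just (a · b) (_· z) (trans (·-assoc a b z)
                                    (trans (cong (_>>= (a ·_)) bz) av))

module Convolution {c ℓ₁ ℓ₂ ι : Level}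
    (S : PartialBiSemigroup ι) (Q : BiQuantale c ℓ₁ ℓ₂ ι)
    (_·_ : PartialOp (PartialBiSemigroup.Carrier S))
    (_⊗_ : BiQuantale.Carrier Q → BiQuantale.Carrier Q → BiQuantale.Carrier Q)
    (⊗-quantale : IsQuantaleMult ι (BiQuantale._≈_ Q) (BiQuantale._≤_ Q) (BiQuantale.⋁ Q) _⊗_)
    where

  open FunctionSpace S Q using (QS; _≈ᶠ_; _≤ᶠ_; ⋁ᶠ; conv; 𝟙)
  open PartialBiSemigroup S using () renaming (Carrier to X)
  open BiQuantale Q using (Carrier; _≈_; _≤_; ⋁)
  open CompleteLatticeFacts (IsBiQuantale.isCompleteLattice (BiQuantale.isBiQuantale Q))
  open IsQuantaleMult ⊗-quantale

  _⊛_ : QS → QS → QS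
  _⊛_ = conv _·_ _⊗_

  ⊛-upper : ∀ f g {y z x} → y · z ≡ just x → (f y ⊗ g z) ≤ (f ⊛ g) x
  ⊛-upper f g {y} {z} yz = ⋁-upper (λ i → f (proj₁ (proj₁ i)) ⊗ g (proj₂ (proj₁ i))) ((y , z) , yz)

  ⊛-least : ∀ f g {x q} → (∀ y z → y · z ≡ just x → (f y ⊗ g z) ≤ q) → (f ⊛ g) x ≤ q
  ⊛-least f g h = ⋁-least _ _ λ { ((y , z) , yz) → h y z yz }

  ⊗-upperˡ : ∀ {I : Set ι} (a : Carrier) (F : I → Carrier) i → (a ⊗ F i) ≤ (a ⊗ ⋁ F)
  ⊗-upperˡ a F i = begin
    a ⊗ F i               ≤⟨ ⋁-upper (λ j → a ⊗ F j) i ⟩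
    ⋁ (λ j → a ⊗ F j)     ≈⟨ ⊗-distribˡ-⋁ a F ⟨
    a ⊗ ⋁ F               ∎

  ⊗-upperʳ : ∀ {I : Set ι} (F : I → Carrier) (a : Carrier) i → (F i ⊗ a) ≤ (⋁ F ⊗ a)
  ⊗-upperʳ F a i = begin
    F i ⊗ a               ≤⟨ ⋁-upper (λ j → F j ⊗ a) i ⟩
    ⋁ (λ j → F j ⊗ a)     ≈⟨ ⊗-distribʳ-⋁ F a ⟨
    ⋁ F ⊗ a               ∎

  ⊗-leastˡ : ∀ {I : Set ι} (a : Carrier) (F : I → Carrier) {q} →
             (∀ i → (a ⊗ F i) ≤ q) → (a ⊗ ⋁ F) ≤ q
  ⊗-leastˡ a F {q} h = begin
    a ⊗ ⋁ F               ≈⟨ ⊗-distribˡ-⋁ a F ⟩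
    ⋁ (λ j → a ⊗ F j)     ≤⟨ ⋁-least _ q h ⟩
    q                     ∎

  ⊗-leastʳ : ∀ {I : Set ι} (F : I → Carrier) (a : Carrier) {q} →
             (∀ i → (F i ⊗ a) ≤ q) → (⋁ F ⊗ a) ≤ q
  ⊗-leastʳ F a {q} h = begin
    ⋁ F ⊗ a               ≈⟨ ⊗-distribʳ-⋁ F a ⟩
    ⋁ (λ j → F j ⊗ a)     ≤⟨ ⋁-least _ q h ⟩
    q                     ∎

  ⊛-cong : ∀ {f f′ g g′} → f ≈ᶠ f′ → g ≈ᶠ g′ → (f ⊛ g) ≈ᶠ (f′ ⊛ g′)
  ⊛-cong f≈f′ g≈g′ x = ⋁-cong (λ i → ⊗-cong (f≈f′ _) (g≈g′ _))

  ⊛-distribˡ-⋁ : ∀ {I : Set ι} (f : QS) (F : I → QS) → (f ⊛ ⋁ᶠ F) ≈ᶠ ⋁ᶠ (λ i → f ⊛ F i)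
  ⊛-distribˡ-⋁ f F x =
    ≈.trans (⋁-cong (λ p → ⊗-distribˡ-⋁ (f (proj₁ (proj₁ p))) _)) (⋁-swap _)

  ⊛-distribʳ-⋁ : ∀ {I : Set ι} (F : I → QS) (f : QS) → (⋁ᶠ F ⊛ f) ≈ᶠ ⋁ᶠ (λ i → F i ⊛ f)
  ⊛-distribʳ-⋁ F f x =
    ≈.trans (⋁-cong (λ p → ⊗-distribʳ-⋁ _ (f (proj₂ (proj₁ p))))) (⋁-swap _)

  -- Both sides of associativity are the supremum of f a ⊗ g b ⊗ h z over the
  -- factorisations x = a · b · z; each term of one side is bounded by the
  -- other side after regrouping the factorisation.
  ⊛-assoc : PartialAssoc _·_ → ∀ f g h → ((f ⊛ g) ⊛ h) ≈ᶠ (f ⊛ (g ⊛ h))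
  ⊛-assoc ·-assoc f g h x = antisym
    (⊛-least _ h λ y z yz → ⊗-leastʳ _ (h z) λ { ((a , b) , ab) →
      let (v , bz , av) = regroupʳ ab yz in begin
        (f a ⊗ g b) ⊗ h z     ≈⟨ ⊗-assoc (f a) (g b) (h z) ⟩
        f a ⊗ (g b ⊗ h z)     ≤⟨ ⊗-upperˡ (f a) _ ((b , z) , bz) ⟩
        f a ⊗ (g ⊛ h) v       ≤⟨ ⊛-upper f (g ⊛ h) av ⟩
        (f ⊛ (g ⊛ h)) x       ∎ })
    (⊛-least f _ λ a v av → ⊗-leastˡ (f a) _ λ { ((b , z) , bz) →
      let (y , ab , yz) = regroupˡ bz av in begin
        f a ⊗ (g b ⊗ h z)     ≈⟨ ⊗-assoc (f a) (g b) (h z) ⟨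
        (f a ⊗ g b) ⊗ h z     ≤⟨ ⊗-upperʳ _ (h z) ((a , b) , ab) ⟩
        (f ⊛ g) y ⊗ h z       ≤⟨ ⊛-upper (f ⊛ g) h yz ⟩
        ((f ⊛ g) ⊛ h) x       ∎ })
    where open Regroup {_·_ = _·_} ·-assoc

  isQuantaleMult : PartialAssoc _·_ → IsQuantaleMult ι _≈ᶠ_ _≤ᶠ_ ⋁ᶠ _⊛_
  isQuantaleMult ·-assoc = record
    { ⊗-cong       = ⊛-cong
    ; ⊗-assoc      = ⊛-assoc ·-assoc
    ; ⊗-distribˡ-⋁ = ⊛-distribˡ-⋁
    ; ⊗-distribʳ-⋁ = ⊛-distribʳ-⋁
    }

  module UnitFunction {u : X} (u-unit : IsPartialUnit _·_ u)
                      {e : Carrier} (e-unit : IsUnit ι _≈_ _≤_ _⊗_ e) where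

    u·-injective : ∀ {z x} → u · z ≡ just x → z ≡ x
    u·-injective uz = just-injective (trans (sym (proj₁ (u-unit _))) uz)

    ·u-injective : ∀ {y x} → y · u ≡ just x → y ≡ x
    ·u-injective yu = just-injective (trans (sym (proj₂ (u-unit _))) yu)

    ⊛-identityˡ : ∀ f → (𝟙 u e ⊛ f) ≈ᶠ f
    ⊛-identityˡ f x = antisym
      (⊛-least _ f λ y z yz → ⊗-leastʳ _ (f z) (bound yz))
      (begin
        f x                 ≈⟨ proj₁ (e-unit (f x)) ⟨
        e ⊗ f x             ≤⟨ ⊗-upperʳ (λ _ → e) (f x) refl ⟩
        𝟙 u e u ⊗ f x       ≤⟨ ⊛-upper (𝟙 u e) f (proj₁ (u-unit x)) ⟩
        (𝟙 u e ⊛ f) x       ∎)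
      where
      bound : ∀ {y z} → y · z ≡ just x → y ≡ u → (e ⊗ f z) ≤ f x
      bound uz refl with refl ← u·-injective uz = reflexive (proj₁ (e-unit (f _)))

    ⊛-identityʳ : ∀ f → (f ⊛ 𝟙 u e) ≈ᶠ f
    ⊛-identityʳ f x = antisym
      (⊛-least f _ λ y z yz → ⊗-leastˡ (f y) _ (bound yz))
      (begin
        f x                 ≈⟨ proj₂ (e-unit (f x)) ⟨
        f x ⊗ e             ≤⟨ ⊗-upperˡ (f x) (λ _ → e) refl ⟩
        f x ⊗ 𝟙 u e u       ≤⟨ ⊛-upper f (𝟙 u e) (proj₂ (u-unit x)) ⟩
        (f ⊛ 𝟙 u e) x       ∎)
      where
      bound : ∀ {y z} → y · z ≡ just x → z ≡ u → (f y ⊗ e) ≤ f x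
      bound yu refl with refl ← ·u-injective yu = reflexive (proj₂ (e-unit (f _)))

    isUnit : IsUnit ι _≈ᶠ_ _≤ᶠ_ _⊛_ (𝟙 u e)
    isUnit f = ⊛-identityˡ f , ⊛-identityʳ f

proposition9p1 : ∀ {c ℓ₁ ℓ₂ ι : Level}
    (S : PartialBiSemigroup ι) (Q : BiQuantale c ℓ₁ ℓ₂ ι) →
    let open FunctionSpace S Q in
    IsBiQuantaleᶠ
    × (BiQuantale.IsDistributive Q → IsDistributiveᶠ)
    × (∀ (e∘ e• : BiQuantale.Carrier Q) → BiQuantale.IsUnital Q e∘ e• →
    ∀ (u∘ u• : PartialBiSemigroup.Carrier S) → IsPartialBiMonoid S u∘ u• →
    IsUnitalᶠ (𝟙 u∘ e∘) (𝟙 u• e•))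
proposition9p1 S Q = isBiQuantale , Pointwise.isDistributive S.Carrier , isUnital
  where
  module S = PartialBiSemigroup S
  module Q = BiQuantale Q
  open FunctionSpace S Q using (IsBiQuantaleᶠ; IsUnitalᶠ; 𝟙)
  open IsBiQuantale Q.isBiQuantale
  module ∘ᶠ = Convolution S Q S._∘_ Q._∘_ ∘-quantale
  module •ᶠ = Convolution S Q S._•_ Q._•_ •-quantale

  isBiQuantale : IsBiQuantaleᶠ
  isBiQuantale = record
    { isCompleteLattice = Pointwise.isCompleteLattice S.Carrier isCompleteLattice
    ; ∘-quantale        = ∘ᶠ.isQuantaleMult S.∘-assoc
    ; •-quantale        = •ᶠ.isQuantaleMult S.•-assoc
    }

  isUnital : ∀ (e∘ e• : Q.Carrier) → Q.IsUnital e∘ e• →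
             ∀ (u∘ u• : S.Carrier) → IsPartialBiMonoid S u∘ u• →
             IsUnitalᶠ (𝟙 u∘ e∘) (𝟙 u• e•)
  isUnital e∘ e• Q-unital u∘ u• S-monoid = record
    { 1∘-unit = ∘ᶠ.UnitFunction.isUnit (IsPartialBiMonoid.1∘-unit S-monoid)
                                       (IsUnitalBiQuantaleUnits.1∘-unit Q-unital)
    ; 1•-unit = •ᶠ.UnitFunction.isUnit (IsPartialBiMonoid.1•-unit S-monoid)
                                       (IsUnitalBiQuantaleUnits.1•-unit Q-unital)
    }
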